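{- Let $(X,\leq)$ be a poset. The relation $\leq$ on the set of regions of $X$, defined by $R\leq S$ iff $R\preceq S$ and ($S\preceq R$ implies $S\subseteq R$), is a partial order.
   Context: An interval of $X$ is a pair $(x,y)$ with $x\leq y$; its support is $[x,y]=\{z\in X:x\leq z\leq y\}$; for intervals $I\subseteq J$ means $[I]\subseteq[J]$. A region is a set of intervals. For regions, $R\preceq S$ iff for every $I\in R$ there exists $J\in S$ with $I\subseteq J$; $S\subseteq R$ denotes inclusion of regions as sets of intervals. -}

module Defs where

open import Level using (Level; _⊔_; suc)
open import Data.Product using (Σ; _×_; _,_; proj₁; proj₂; ∃-syntax)
open import Relation.Binary.Bundles using (Poset)

module Regions {c ℓ₁ ℓ₂ : Level} (P : Poset c ℓ₁ ℓ₂) where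
  open Poset P renaming (Carrier to X)

  Interval : Set (c ⊔ ℓ₂)
  Interval = Σ (X × X) (λ p → proj₁ p ≤ proj₂ p)

  lo hi : Interval → X
  lo I = proj₁ (proj₁ I)
  hi I = proj₂ (proj₁ I)

  _∈supp_ : X → Interval → Set ℓ₂
  z ∈supp I = (lo I ≤ z) × (z ≤ hi I)

  _⊆ᵢ_ : Interval → Interval → Set (c ⊔ ℓ₂)
  I ⊆ᵢ J = ∀ z → z ∈supp I → z ∈supp J

  Region : (r : Level) → Set (c ⊔ ℓ₂ ⊔ suc r)
  Region r = Interval → Set r

  _⪯_ : ∀ {r} → Region r → Region r → Set (c ⊔ ℓ₂ ⊔ r)
  R ⪯ S = ∀ I → R I → ∃[ J ] (S J × (I ⊆ᵢ J))

  _⊆ᵣ_ : ∀ {r} → Region r → Region r → Set (c ⊔ ℓ₂ ⊔ r)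
  S ⊆ᵣ R = ∀ I → S I → R I

  _≐_ : ∀ {r} → Region r → Region r → Set (c ⊔ ℓ₂ ⊔ r)
  R ≐ S = (R ⊆ᵣ S) × (S ⊆ᵣ R)

  _≤ᵣ_ : ∀ {r} → Region r → Region r → Set (c ⊔ ℓ₂ ⊔ r)
  R ≤ᵣ S = (R ⪯ S) × (S ⪯ R → S ⊆ᵣ R)

-- Only the preorder ⪯ and set inclusion are involved.
-- The side condition "S ⪯ R implies S ⊆ R" is what makes ≤ᵣ antisymmetric up to ≐,
-- and it survives composition because ⪯ is transitive.

module Submission where

open import Defs
open import Level using (Level)
open import Relation.Binary.Bundles using (Poset)
open import Relation.Binary.Structures using (IsPartialOrder; IsEquivalence)
open import Data.Product using (_,_)

module RegionOrder {c ℓ₁ ℓ₂ : Level} (P : Poset c ℓ₁ ℓ₂) {r : Level} where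
  open Regions P

  ⊆ᵢ-refl : ∀ I → I ⊆ᵢ I
  ⊆ᵢ-refl I z z∈I = z∈I

  ⊆ᵢ-trans : ∀ {I J K} → I ⊆ᵢ J → J ⊆ᵢ K → I ⊆ᵢ K
  ⊆ᵢ-trans I⊆J J⊆K z z∈I = J⊆K z (I⊆J z z∈I)

  ⊆ᵣ-refl : {R : Region r} → R ⊆ᵣ R
  ⊆ᵣ-refl I RI = RI

  ⊆ᵣ-trans : {R S T : Region r} → R ⊆ᵣ S → S ⊆ᵣ T → R ⊆ᵣ T
  ⊆ᵣ-trans R⊆S S⊆T I RI = S⊆T I (R⊆S I RI)

  ⊆ᵣ⇒⪯ : {R S : Region r} → R ⊆ᵣ S → R ⪯ S
  ⊆ᵣ⇒⪯ R⊆S I RI = I , R⊆S I RI , ⊆ᵢ-refl I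

  ⪯-trans : {R S T : Region r} → R ⪯ S → S ⪯ T → R ⪯ T
  ⪯-trans R⪯S S⪯T I RI with R⪯S I RI
  ... | J , SJ , I⊆J with S⪯T J SJ
  ... | K , TK , J⊆K = K , TK , ⊆ᵢ-trans {I} {J} {K} I⊆J J⊆K

  ≐-isEquivalence : IsEquivalence (_≐_ {r})
  ≐-isEquivalence = record
    { refl  = ⊆ᵣ-refl , ⊆ᵣ-refl
    ; sym   = λ { (R⊆S , S⊆R) → S⊆R , R⊆S }
    ; trans = λ { (R⊆S , S⊆R) (S⊆T , T⊆S) → ⊆ᵣ-trans R⊆S S⊆T , ⊆ᵣ-trans T⊆S S⊆R }
    }

  ≤ᵣ-reflexive : {R S : Region r} → R ≐ S → R ≤ᵣ S
  ≤ᵣ-reflexive (R⊆S , S⊆R) = ⊆ᵣ⇒⪯ R⊆S , λ _ → S⊆R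

  -- If T ⪯ R, then T ⪯ S through R ⪯ S and S ⪯ R through S ⪯ T,
  -- so both side conditions fire and T ⊆ S ⊆ R.
  ≤ᵣ-trans : {R S T : Region r} → R ≤ᵣ S → S ≤ᵣ T → R ≤ᵣ T
  ≤ᵣ-trans (R⪯S , S⪯R⇒S⊆R) (S⪯T , T⪯S⇒T⊆S) =
    ⪯-trans R⪯S S⪯T ,
    λ T⪯R → ⊆ᵣ-trans (T⪯S⇒T⊆S (⪯-trans T⪯R R⪯S))
                     (S⪯R⇒S⊆R (⪯-trans S⪯T T⪯R))

  ≤ᵣ-antisym : {R S : Region r} → R ≤ᵣ S → S ≤ᵣ R → R ≐ S
  ≤ᵣ-antisym (R⪯S , S⪯R⇒S⊆R) (S⪯R , R⪯S⇒R⊆S) = R⪯S⇒R⊆S R⪯S , S⪯R⇒S⊆R S⪯R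

  ≤ᵣ-isPartialOrder : IsPartialOrder (_≐_ {r}) (_≤ᵣ_ {r})
  ≤ᵣ-isPartialOrder = record
    { isPreorder = record
      { isEquivalence = ≐-isEquivalence
      ; reflexive     = ≤ᵣ-reflexive
      ; trans         = ≤ᵣ-trans
      }
    ; antisym = ≤ᵣ-antisym
    }

lemma5p4 : {c ℓ₁ ℓ₂ : Level} (P : Poset c ℓ₁ ℓ₂) (r : Level) →
    IsPartialOrder (Regions._≐_ P {r}) (Regions._≤ᵣ_ P {r})
lemma5p4 P r = RegionOrder.≤ᵣ-isPartialOrder P {r}
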